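{- Let $k\geq 3$, $1\le t<k$, and let $x\in\{0,1\}^k$ have weight $d$ with $1\le d<k$ and $d\neq t$. Then, unless $t$ is odd, $k$ is even and $d$ is odd, there is an odd $m$ such that $\mathrm{Pol}(\mathbf{I}_{t,k}\cup\{x\},\mathbf{NAE}_k)$ contains no 2-block-symmetric function of arity $m$ (i.e. the template does not have 2-block-symmetric polymorphisms of all odd arities).
   Context: Weight of a Boolean tuple = number of 1's. $\mathbf{I}_{t,k}\cup\{x\}$: Boolean structure whose single $k$-ary relation is the set of all tuples of weight $t$ together with $x$. $\mathbf{NAE}_k$: Boolean structure with the $k$-ary relation $\{0,1\}^k\setminus\{0^k,1^k\}$. A polymorphism of arity $m$ of a template $(\mathbf{A},\mathbf{B})$ with single $k$-ary relations $R,S$ is $f:A^m\to B$ such that for every $k\times m$ matrix whose columns lie in $R$, applying $f$ to each row yields a tuple in $S$; $\mathrm{Pol}(\mathbf{A},\mathbf{B})$ is the set of polymorphisms. A function $f$ of odd arity $2n+1$ is 2-block-symmetric if $f(a_1,\dots,a_{2n+1})=f(a_{\pi(1)},\dots,a_{\pi(2n+1)})$ for every permutation $\pi$ of $[2n+1]$ preserving parity (i.e. invariant under permutations within the odd coordinates and within the even coordinates). -}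

module Defs where

open import Data.Nat using (ℕ; zero; suc; _+_; _%_)
open import Data.Bool using (Bool; true; false; if_then_else_)
open import Data.Fin using (Fin; toℕ)
import Data.Fin as Fin
open import Data.Product using (Σ; ∃; _×_; _,_)
open import Data.Sum using (_⊎_)
open import Data.Fin.Permutation using (Permutation′; _⟨$⟩ʳ_)
open import Relation.Binary.PropositionalEquality using (_≡_)
open import Relation.Nullary using (¬_)

Even : ℕ → Set
Even n = n % 2 ≡ 0

Odd : ℕ → Set
Odd n = n % 2 ≡ 1

Tuple : ℕ → Set
Tuple k = Fin k → Bool

weight : {k : ℕ} → Tuple k → ℕ
weight {zero}  y = 0
weight {suc k} y = (if y Fin.zero then 1 else 0) + weight {k} (λ i → y (Fin.suc i))

Rel-I∪ : (k t : ℕ) → Tuple k → Tuple k → Set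
Rel-I∪ k t x y = weight y ≡ t ⊎ (∀ i → y i ≡ x i)

Rel-NAE : (k : ℕ) → Tuple k → Set
Rel-NAE k y = ∃ λ i → ∃ λ j → (y i ≡ true) × (y j ≡ false)

IsPolymorphism : (k t : ℕ) → Tuple k → (m : ℕ) → (Tuple m → Bool) → Set
IsPolymorphism k t x m f =
  (M : Fin k → Fin m → Bool) →
  (∀ (j : Fin m) → Rel-I∪ k t x (λ i → M i j)) →
  Rel-NAE k (λ i → f (M i))

-- π preserves parity of coordinates (1-based parity = 0-based parity)
ParityPreserving : {m : ℕ} → Permutation′ m → Set
ParityPreserving {m} π = ∀ (i : Fin m) → toℕ (π ⟨$⟩ʳ i) % 2 ≡ toℕ i % 2

TwoBlockSymmetric : (m : ℕ) → (Tuple m → Bool) → Set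
TwoBlockSymmetric m f =
  (π : Permutation′ m) → ParityPreserving π →
  ∀ (a : Tuple m) → f a ≡ f (λ i → a (π ⟨$⟩ʳ i))

module Submission where

-- A 2-block-symmetric f of arity 2n + 1 only sees the weights a, b of its two blocks; write
-- F a b.  After complementing everything if necessary, t < d; write k = t + K, d = t + D with
-- 1 ≤ D < K, n = 4k², B = 4kt.  If w V + (k − w) V′ = p d + (n + 1 − p) t, there is a
-- k × (2n + 1) matrix with all columns in I_{t,k} ∪ {x} whose first block has w rows of weight V
-- and k − w of weight V′, and whose second block has all rows of weight B: take p copies of x
-- and fill the rest with weight-t columns by wrapping the rows around a grid of t lines.  The rows
-- are then not all equal under f, so F V B ≢ F V′ B.  For V = 4kt + α this separates the levels
-- α = 0, 1, 2 (or 1, 2, 3 when t, k and d are all odd), and three Booleans cannot be pairwise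
-- distinct.

open import Defs
open import Data.Nat using (ℕ; _≤_; _<_)
open import Data.Bool using (Bool)
open import Data.Product using (Σ; ∃; _×_)
open import Relation.Binary.PropositionalEquality using (_≡_; _≢_)
open import Relation.Nullary using (¬_)

open import Data.Bool using (true; false; if_then_else_; not)
open import Data.Bool.Properties using (¬-not; not-involutive)
open import Data.Empty using (⊥; ⊥-elim)
open import Data.Fin using (Fin; toℕ)
import Data.Fin as Fin
open import Data.Fin.Permutation using (Permutation′; _⟨$⟩ʳ_)
import Data.Fin.Permutation as Perm
open import Data.Fin.Properties using (toℕ<n; toℕ-fromℕ)
open import Data.Nat using (zero; suc; _+_; _*_; _∸_; _⊓_; _%_; _<ᵇ_; z≤n; s≤s)
open import Data.Nat.DivMod using (_/_; m%n<n; m≡m%n+[m/n]*n; %-distribˡ-+)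
open import Data.Nat.Properties
open import Algebra.Properties.CommutativeSemigroup +-commutativeSemigroup using (x∙yz≈y∙xz)
open import Algebra.Properties.Semiring.Sum +-*-semiring
  using (sum; sum-syntax; sum-cong-≗; ∑-distrib-+; *-distribˡ-sum)
open import Data.Nat.Tactic.RingSolver using (solve-∀)
open import Data.Product using (_,_; proj₁; proj₂)
open import Data.Sum using (_⊎_; inj₁; inj₂; [_,_]′)
import Data.Sum as Sum
open import Data.Sum.Function.Propositional using (_⊎-↔_)
open import Data.Vec.Functional using (_++_; replicate)
open import Function using (_∘_)
open import Function.Bundles using (_↔_; mk↔ₛ′)
open import Function.Construct.Composition using (_↔-∘_)
open import Function.Construct.Symmetry using (↔-sym)
open import Relation.Binary.Definitions using (tri<; tri≈; tri>)
open import Relation.Binary.PropositionalEquality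
  using (refl; sym; trans; cong; cong₂; subst; module ≡-Reasoning)
open import Relation.Nullary using (yes; no)

bit : Bool → ℕ
bit b = if b then 1 else 0

bit≤1 : ∀ b → bit b ≤ 1
bit≤1 true  = ≤-refl
bit≤1 false = z≤n

∑-const : ∀ k c → ∑[ i < k ] c ≡ k * c
∑-const zero    c = refl
∑-const (suc k) c = cong (c +_) (∑-const k c)

∑-∸ : ∀ {k} (g h : Fin k → ℕ) → (∀ i → h i ≤ g i) →
      ∑[ i < k ] (g i ∸ h i) ≡ ∑[ i < k ] g i ∸ ∑[ i < k ] h i
∑-∸ {k} g h h≤g = begin
  ∑[ i < k ] (g i ∸ h i)                           ≡⟨ m+n∸n≡m _ (sum h) ⟨
  ∑[ i < k ] (g i ∸ h i) + sum h ∸ sum h           ≡⟨ cong (_∸ sum h) (∑-distrib-+ (λ i → g i ∸ h i) h) ⟨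
  ∑[ i < k ] (g i ∸ h i + h i) ∸ sum h             ≡⟨ cong (_∸ sum h) (sum-cong-≗ (λ i → m∸n+n≡m (h≤g i))) ⟩
  sum g ∸ sum h                                    ∎
  where open ≡-Reasoning

weight≡∑ : ∀ {k} (y : Tuple k) → weight y ≡ ∑[ i < k ] bit (y i)
weight≡∑ {zero}  y = refl
weight≡∑ {suc k} y = cong (bit (y Fin.zero) +_) (weight≡∑ (y ∘ Fin.suc))

weight-cong : ∀ {k} {y y′ : Tuple k} → (∀ i → y i ≡ y′ i) → weight y ≡ weight y′
weight-cong {zero}  eq = refl
weight-cong {suc k} eq = cong₂ (λ b w → bit b + w) (eq Fin.zero) (weight-cong (eq ∘ Fin.suc))

weight≤ : ∀ {k} (y : Tuple k) → weight y ≤ k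
weight≤ {zero}  y = z≤n
weight≤ {suc k} y = +-mono-≤ (bit≤1 (y Fin.zero)) (weight≤ (y ∘ Fin.suc))

weight-replicate : ∀ m b → weight (replicate m b) ≡ m * bit b
weight-replicate zero    b = refl
weight-replicate (suc m) b = cong (bit b +_) (weight-replicate m b)

weight-++ : ∀ {m n} (u : Tuple m) (v : Tuple n) → weight (u ++ v) ≡ weight u + weight v
weight-++ {zero}  u v = refl
weight-++ {suc m} u v = begin
  bit (u Fin.zero) + weight (λ i → (u ++ v) (Fin.suc i)) ≡⟨ cong (bit (u Fin.zero) +_) (weight-cong tail-++) ⟩
  bit (u Fin.zero) + weight ((u ∘ Fin.suc) ++ v)        ≡⟨ cong (bit (u Fin.zero) +_) (weight-++ (u ∘ Fin.suc) v) ⟩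
  bit (u Fin.zero) + (weight (u ∘ Fin.suc) + weight v)  ≡⟨ +-assoc (bit (u Fin.zero)) _ _ ⟨
  weight u + weight v                                   ∎
  where
  open ≡-Reasoning
  tail-++ : ∀ i → (u ++ v) (Fin.suc i) ≡ ((u ∘ Fin.suc) ++ v) i
  tail-++ i with Fin.splitAt m i
  ... | inj₁ _ = refl
  ... | inj₂ _ = refl

weight-not : ∀ {k} (y : Tuple k) → weight (not ∘ y) ≡ k ∸ weight y
weight-not {k} y = begin
  weight (not ∘ y)                       ≡⟨ m+n∸n≡m _ (weight y) ⟨
  weight (not ∘ y) + weight y ∸ weight y ≡⟨ cong (_∸ weight y) (complement-+ y) ⟩
  k ∸ weight y                           ∎
  where
  open ≡-Reasoning
  complement-+ : ∀ {k} (y : Tuple k) → weight (not ∘ y) + weight y ≡ k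
  complement-+ {zero}  y = refl
  complement-+ {suc k} y with y Fin.zero | complement-+ (y ∘ Fin.suc)
  ... | true  | eq = trans (+-suc _ _) (cong suc eq)
  ... | false | eq = cong suc eq

∑-if : ∀ {k} (y : Tuple k) a b →
       ∑[ i < k ] (if y i then a else b) ≡ weight y * a + weight (not ∘ y) * b
∑-if {zero}  y a b = refl
∑-if {suc k} y a b with y Fin.zero
... | true  = trans (cong (a +_) (∑-if (y ∘ Fin.suc) a b)) (sym (+-assoc a _ _))
... | false = trans (cong (b +_) (∑-if (y ∘ Fin.suc) a b)) (x∙yz≈y∙xz b (weight (y ∘ Fin.suc) * a) _)

∑-scaled-bits : ∀ {k} p (y : Tuple k) → ∑[ i < k ] (p * bit (y i)) ≡ p * weight y
∑-scaled-bits p y = trans (sym (*-distribˡ-sum p (bit ∘ y))) (cong (p *_) (sym (weight≡∑ y)))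

<ᵇ-false : ∀ {m n} → n ≤ m → (m <ᵇ n) ≡ false
<ᵇ-false {m}     {zero}  _         = refl
<ᵇ-false {suc m} {suc n} (s≤s n≤m) = <ᵇ-false n≤m

<ᵇ-true : ∀ {m n} → m < n → (m <ᵇ n) ≡ true
<ᵇ-true {zero}  {suc n} _         = refl
<ᵇ-true {suc m} {suc n} (s≤s m<n) = <ᵇ-true m<n

bit-<ᵇ : ∀ {m n} → m ≤ n → n ≤ suc m → bit (m <ᵇ n) ≡ n ∸ m
bit-<ᵇ {m} m≤n n≤1+m with m≤n⇒m<n∨m≡n m≤n
... | inj₂ refl    rewrite <ᵇ-false (≤-refl {m}) | n∸n≡0 m = refl
... | inj₁ m<n with ≤-antisym n≤1+m m<n
...   | refl rewrite <ᵇ-true m<n | m+n∸n≡m 1 m = refl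

-- Matrices with prescribed row and column weights

-- hits N t j y = #{ l < t ∣ j + l * N < y }
hits : (N t j y : ℕ) → ℕ
hits N zero    j y = 0
hits N (suc t) j y = bit (j <ᵇ y) + hits N t (j + N) y

bit-<ᵇ-monoʳ : ∀ j {y y′} → y ≤ y′ → bit (j <ᵇ y) ≤ bit (j <ᵇ y′)
bit-<ᵇ-monoʳ j       {zero}           _          = z≤n
bit-<ᵇ-monoʳ zero    {suc _} {suc _}  _          = ≤-refl
bit-<ᵇ-monoʳ (suc j) {suc _} {suc _}  (s≤s y≤y′) = bit-<ᵇ-monoʳ j y≤y′

hits-monoʳ : ∀ N t j {y y′} → y ≤ y′ → hits N t j y ≤ hits N t j y′
hits-monoʳ N zero    j y≤y′ = z≤n
hits-monoʳ N (suc t) j y≤y′ = +-mono-≤ (bit-<ᵇ-monoʳ j y≤y′) (hits-monoʳ N t (j + N) y≤y′)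

hits-none : ∀ N t j y → y ≤ j → hits N t j y ≡ 0
hits-none N zero    j y _   = refl
hits-none N (suc t) j y y≤j rewrite <ᵇ-false y≤j = hits-none N t (j + N) y (≤-trans y≤j (m≤m+n j N))

hits-≤1 : ∀ N t j y → y ≤ j + N → hits N t j y ≤ 1
hits-≤1 N zero    j y _ = z≤n
hits-≤1 N (suc t) j y y≤j+N
  rewrite hits-none N t (j + N) y y≤j+N | +-identityʳ (bit (j <ᵇ y)) = bit≤1 (j <ᵇ y)

hits-step : ∀ N t j {y y′} → y′ ≤ y + N → hits N t j y′ ≤ suc (hits N t j y)
hits-step N zero    j _ = z≤n
hits-step N (suc t) j {y} {y′} y′≤y+N with j <? y
... | no j≮y = ≤-trans (hits-≤1 N (suc t) j y′ (≤-trans y′≤y+N (+-monoˡ-≤ N (≮⇒≥ j≮y)))) (s≤s z≤n)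
... | yes j<y rewrite <ᵇ-true j<y = +-mono-≤ (bit≤1 (j <ᵇ y′)) (hits-step N t (j + N) y′≤y+N)

hits-all : ∀ N t j y → j + t * N < y + N → hits N t j y ≡ t
hits-all N zero    j y _  = refl
hits-all N (suc t) j y lt = cong₂ _+_ (cong bit (<ᵇ-true j<y)) (hits-all N t (j + N) y lt′)
  where
  j<y : j < y
  j<y = +-cancelʳ-< N j y (≤-<-trans (+-monoʳ-≤ j (m≤m+n N (t * N))) lt)
  lt′ : j + N + t * N < y + N
  lt′ = subst (_< y + N) (sym (+-assoc j N (t * N))) lt

∑-bits : ∀ N c z → ∑[ j < N ] bit (c + toℕ j <ᵇ z) ≡ (z ∸ c) ⊓ N
∑-bits N       (suc c) (suc z) = ∑-bits N c z
∑-bits N       c       zero    = trans (∑-const N 0) (trans (*-zeroʳ N) (cong (_⊓ N) (sym (0∸n≡0 c))))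
∑-bits zero    zero    (suc z) = refl
∑-bits (suc N) zero    (suc z) = cong suc (∑-bits N zero z)

⊓-+-split : ∀ z N M → z ⊓ N + (z ∸ N) ⊓ M ≡ z ⊓ (N + M)
⊓-+-split z N M with ≤-total z N
... | inj₁ z≤N rewrite m≤n⇒m⊓n≡m z≤N | m≤n⇒m∸n≡0 z≤N | +-identityʳ z
    = sym (m≤n⇒m⊓n≡m (≤-trans z≤N (m≤m+n N M)))
... | inj₂ N≤z rewrite m≥n⇒m⊓n≡n N≤z = begin
  N + (z ∸ N) ⊓ M          ≡⟨ +-distribˡ-⊓ N (z ∸ N) M ⟩
  (N + (z ∸ N)) ⊓ (N + M)  ≡⟨ cong (_⊓ (N + M)) (m+[n∸m]≡n N≤z) ⟩
  z ⊓ (N + M)              ∎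
  where open ≡-Reasoning

∑-hits : ∀ N t c z → ∑[ j < N ] hits N t (c + toℕ j) z ≡ (z ∸ c) ⊓ (t * N)
∑-hits N zero    c z = trans (∑-const N 0) (trans (*-zeroʳ N) (sym (⊓-zeroʳ (z ∸ c))))
∑-hits N (suc t) c z = begin
  ∑[ j < N ] (bit (c + toℕ j <ᵇ z) + hits N t (c + toℕ j + N) z)
    ≡⟨ ∑-distrib-+ {N} (λ j → bit (c + toℕ j <ᵇ z)) (λ j → hits N t (c + toℕ j + N) z) ⟩
  ∑[ j < N ] bit (c + toℕ j <ᵇ z) + ∑[ j < N ] hits N t (c + toℕ j + N) z
    ≡⟨ cong (∑[ j < N ] bit (c + toℕ j <ᵇ z) +_) (sum-cong-≗ {N} (λ j → cong (λ o → hits N t o z) (shift j))) ⟩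
  ∑[ j < N ] bit (c + toℕ j <ᵇ z) + ∑[ j < N ] hits N t (c + N + toℕ j) z
    ≡⟨ cong₂ _+_ (∑-bits N c z) (∑-hits N t (c + N) z) ⟩
  (z ∸ c) ⊓ N + (z ∸ (c + N)) ⊓ (t * N)
    ≡⟨ cong (λ o → (z ∸ c) ⊓ N + o ⊓ (t * N)) (sym (∸-+-assoc z c N)) ⟩
  (z ∸ c) ⊓ N + (z ∸ c ∸ N) ⊓ (t * N)
    ≡⟨ ⊓-+-split (z ∸ c) N (t * N) ⟩
  (z ∸ c) ⊓ (N + t * N) ∎
  where
  open ≡-Reasoning
  shift : ∀ j → c + toℕ j + N ≡ c + N + toℕ j
  shift j = trans (+-assoc c (toℕ j) N) (trans (cong (c +_) (+-comm (toℕ j) N)) (sym (+-assoc c N (toℕ j))))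

-- Lay out the rows one after the other in a t × N grid read row by row: row i takes the
-- r i cells following the S + r 0 + ⋯ + r (i - 1) earlier ones, and its entry in column j
-- records whether one of those cells lies in column j.  Since r i ≤ N this happens at most once.
wrapAround : ∀ {k} (N t : ℕ) → (Fin k → ℕ) → ℕ → Fin k → ℕ → Bool
wrapAround N t r S Fin.zero    j = hits N t j S <ᵇ hits N t j (S + r Fin.zero)
wrapAround N t r S (Fin.suc i) j = wrapAround N t (r ∘ Fin.suc) (S + r Fin.zero) i j

bit-wrapAround : ∀ N t S a j → a ≤ N →
  bit (hits N t j S <ᵇ hits N t j (S + a)) ≡ hits N t j (S + a) ∸ hits N t j S
bit-wrapAround N t S a j a≤N =
  bit-<ᵇ (hits-monoʳ N t j (m≤m+n S a)) (hits-step N t j (+-monoʳ-≤ S a≤N))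

∸-telescope : ∀ {a b c} → a ≤ b → b ≤ c → (b ∸ a) + (c ∸ b) ≡ c ∸ a
∸-telescope {a} {b} {c} a≤b b≤c = begin
  (b ∸ a) + (c ∸ b) ≡⟨ +-comm (b ∸ a) (c ∸ b) ⟩
  (c ∸ b) + (b ∸ a) ≡⟨ +-∸-assoc (c ∸ b) a≤b ⟨
  (c ∸ b) + b ∸ a   ≡⟨ cong (_∸ a) (m∸n+n≡m b≤c) ⟩
  c ∸ a             ∎
  where open ≡-Reasoning

wrapAround-columnWeight : ∀ {k} N t (r : Fin k → ℕ) S j → (∀ i → r i ≤ N) →
  weight (λ i → wrapAround N t r S i j) ≡ hits N t j (S + ∑[ i < k ] r i) ∸ hits N t j S
wrapAround-columnWeight {zero}  N t r S j _ rewrite +-identityʳ S = sym (n∸n≡0 (hits N t j S))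
wrapAround-columnWeight {suc k} N t r S j r≤N = begin
  bit (wrapAround N t r S Fin.zero j) + weight (λ i → wrapAround N t (r ∘ Fin.suc) S′ i j)
    ≡⟨ cong₂ _+_ (bit-wrapAround N t S (r Fin.zero) j (r≤N Fin.zero))
                 (wrapAround-columnWeight N t (r ∘ Fin.suc) S′ j (r≤N ∘ Fin.suc)) ⟩
  (hits N t j S′ ∸ hits N t j S) + (hits N t j (S′ + sum (r ∘ Fin.suc)) ∸ hits N t j S′)
    ≡⟨ ∸-telescope (hits-monoʳ N t j (m≤m+n S (r Fin.zero))) (hits-monoʳ N t j (m≤m+n S′ _)) ⟩
  hits N t j (S′ + sum (r ∘ Fin.suc)) ∸ hits N t j S
    ≡⟨ cong (λ o → hits N t j o ∸ hits N t j S) (+-assoc S (r Fin.zero) _) ⟩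
  hits N t j (S + sum r) ∸ hits N t j S ∎
  where
  open ≡-Reasoning
  S′ = S + r Fin.zero

wrapAround-rowWeight : ∀ {k} N t (r : Fin k → ℕ) S i → (∀ i → r i ≤ N) → S + ∑[ i < k ] r i ≤ t * N →
  weight {N} (λ j → wrapAround N t r S i (toℕ j)) ≡ r i
wrapAround-rowWeight N t r S Fin.zero r≤N bound = begin
  weight {N} (λ j → wrapAround N t r S Fin.zero (toℕ j))
    ≡⟨ weight≡∑ {N} (λ j → wrapAround N t r S Fin.zero (toℕ j)) ⟩
  ∑[ j < N ] bit (wrapAround N t r S Fin.zero (toℕ j))
    ≡⟨ sum-cong-≗ {N} (λ j → bit-wrapAround N t S (r Fin.zero) (toℕ j) (r≤N Fin.zero)) ⟩
  ∑[ j < N ] (hits N t (toℕ j) S′ ∸ hits N t (toℕ j) S)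
    ≡⟨ ∑-∸ {N} (λ j → hits N t (toℕ j) S′) (λ j → hits N t (toℕ j) S)
           (λ j → hits-monoʳ N t (toℕ j) (m≤m+n S (r Fin.zero))) ⟩
  ∑[ j < N ] hits N t (toℕ j) S′ ∸ ∑[ j < N ] hits N t (toℕ j) S
    ≡⟨ cong₂ _∸_ (∑-hits N t 0 S′) (∑-hits N t 0 S) ⟩
  S′ ⊓ (t * N) ∸ S ⊓ (t * N)
    ≡⟨ cong₂ _∸_ (m≤n⇒m⊓n≡m S′≤tN) (m≤n⇒m⊓n≡m (≤-trans (m≤m+n S (r Fin.zero)) S′≤tN)) ⟩
  S′ ∸ S
    ≡⟨ m+n∸m≡n S (r Fin.zero) ⟩
  r Fin.zero ∎
  where
  open ≡-Reasoning
  S′ = S + r Fin.zero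
  S′≤tN : S′ ≤ t * N
  S′≤tN = ≤-trans (m≤m+n S′ _) (subst (_≤ t * N) (sym (+-assoc S (r Fin.zero) _)) bound)
wrapAround-rowWeight N t r S (Fin.suc i) r≤N bound =
  wrapAround-rowWeight N t (r ∘ Fin.suc) (S + r Fin.zero) i (r≤N ∘ Fin.suc)
    (subst (_≤ t * N) (sym (+-assoc S (r Fin.zero) _)) bound)

matrixWithMargins : ∀ {k} N t (r : Fin k → ℕ) → (∀ i → r i ≤ N) → ∑[ i < k ] r i ≡ t * N →
  Σ (Fin k → Tuple N) λ M → (∀ i → weight (M i) ≡ r i) × (∀ j → weight (λ i → M i j) ≡ t)
matrixWithMargins N t r r≤N ∑r =
    (λ i j → wrapAround N t r 0 i (toℕ j))
  , (λ i → wrapAround-rowWeight N t r 0 i r≤N (≤-reflexive ∑r))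
  , column
  where
  column : ∀ (j : Fin N) → weight (λ i → wrapAround N t r 0 i (toℕ j)) ≡ t
  column j = begin
    weight (λ i → wrapAround N t r 0 i (toℕ j))
      ≡⟨ wrapAround-columnWeight N t r 0 (toℕ j) r≤N ⟩
    hits N t (toℕ j) (sum r) ∸ hits N t (toℕ j) 0
      ≡⟨ cong₂ _∸_ (cong (hits N t (toℕ j)) ∑r) (hits-none N t (toℕ j) 0 z≤n) ⟩
    hits N t (toℕ j) (t * N)
      ≡⟨ hits-all N t (toℕ j) (t * N) (subst (_< t * N + N) (+-comm (t * N) (toℕ j)) (+-monoʳ-< (t * N) (toℕ<n j))) ⟩
    t ∎
    where open ≡-Reasoning

-- Interleaving two blocks

twice+1 : ℕ → ℕ
twice+1 zero    = 1
twice+1 (suc n) = suc (suc (twice+1 n))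

twice+1-odd : ∀ n → Odd (twice+1 n)
twice+1-odd zero    = refl
twice+1-odd (suc n) = twice+1-odd n

-- The first block consists of the even positions (the odd coordinates, counting from 1).
toBlocks : ∀ {n} → Fin (twice+1 n) → Fin (suc n) ⊎ Fin n
toBlocks {zero}  Fin.zero              = inj₁ Fin.zero
toBlocks {suc n} Fin.zero              = inj₁ Fin.zero
toBlocks {suc n} (Fin.suc Fin.zero)    = inj₂ Fin.zero
toBlocks {suc n} (Fin.suc (Fin.suc l)) = Sum.map Fin.suc Fin.suc (toBlocks l)

fromBlocks : ∀ {n} → Fin (suc n) ⊎ Fin n → Fin (twice+1 n)
fromBlocks {zero}  (inj₁ Fin.zero)    = Fin.zero
fromBlocks {suc n} (inj₁ Fin.zero)    = Fin.zero
fromBlocks {suc n} (inj₁ (Fin.suc a)) = Fin.suc (Fin.suc (fromBlocks (inj₁ a)))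
fromBlocks {suc n} (inj₂ Fin.zero)    = Fin.suc Fin.zero
fromBlocks {suc n} (inj₂ (Fin.suc b)) = Fin.suc (Fin.suc (fromBlocks (inj₂ b)))

toBlocks-fromBlocks : ∀ {n} (s : Fin (suc n) ⊎ Fin n) → toBlocks (fromBlocks s) ≡ s
toBlocks-fromBlocks {zero}  (inj₁ Fin.zero)    = refl
toBlocks-fromBlocks {suc n} (inj₁ Fin.zero)    = refl
toBlocks-fromBlocks {suc n} (inj₁ (Fin.suc a)) = cong (Sum.map Fin.suc Fin.suc) (toBlocks-fromBlocks (inj₁ a))
toBlocks-fromBlocks {suc n} (inj₂ Fin.zero)    = refl
toBlocks-fromBlocks {suc n} (inj₂ (Fin.suc b)) = cong (Sum.map Fin.suc Fin.suc) (toBlocks-fromBlocks (inj₂ b))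

fromBlocks-toBlocks : ∀ {n} (l : Fin (twice+1 n)) → fromBlocks (toBlocks l) ≡ l
fromBlocks-toBlocks {zero}  Fin.zero              = refl
fromBlocks-toBlocks {suc n} Fin.zero              = refl
fromBlocks-toBlocks {suc n} (Fin.suc Fin.zero)    = refl
fromBlocks-toBlocks {suc n} (Fin.suc (Fin.suc l)) with toBlocks l | fromBlocks-toBlocks l
... | inj₁ _ | eq = cong (Fin.suc ∘ Fin.suc) eq
... | inj₂ _ | eq = cong (Fin.suc ∘ Fin.suc) eq

blocks : ∀ {n} → Fin (twice+1 n) ↔ (Fin (suc n) ⊎ Fin n)
blocks = mk↔ₛ′ toBlocks fromBlocks toBlocks-fromBlocks fromBlocks-toBlocks

interleave : ∀ {n} → Tuple (suc n) → Tuple n → Tuple (twice+1 n)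
interleave u v l = [ u , v ]′ (toBlocks l)

blockIndex : ∀ {n} → Fin (suc n) ⊎ Fin n → ℕ
blockIndex (inj₁ _) = 0
blockIndex (inj₂ _) = 1

toℕ-%2 : ∀ {n} (l : Fin (twice+1 n)) → toℕ l % 2 ≡ blockIndex (toBlocks l)
toℕ-%2 {zero}  Fin.zero              = refl
toℕ-%2 {suc n} Fin.zero              = refl
toℕ-%2 {suc n} (Fin.suc Fin.zero)    = refl
toℕ-%2 {suc n} (Fin.suc (Fin.suc l)) with toBlocks l | toℕ-%2 l
... | inj₁ _ | eq = eq
... | inj₂ _ | eq = eq

blockPermutation : ∀ {n} → Permutation′ (suc n) → Permutation′ n → Permutation′ (twice+1 n)
blockPermutation σ ρ = ↔-sym blocks ↔-∘ ((σ ⊎-↔ ρ) ↔-∘ blocks)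

blockPermutation-parityPreserving : ∀ {n} (σ : Permutation′ (suc n)) (ρ : Permutation′ n) →
                                    ParityPreserving (blockPermutation σ ρ)
blockPermutation-parityPreserving σ ρ l = begin
  toℕ (fromBlocks s′) % 2               ≡⟨ toℕ-%2 (fromBlocks s′) ⟩
  blockIndex (toBlocks (fromBlocks s′)) ≡⟨ cong blockIndex (toBlocks-fromBlocks s′) ⟩
  blockIndex s′                         ≡⟨ blockIndex-map (toBlocks l) ⟩
  blockIndex (toBlocks l)               ≡⟨ toℕ-%2 l ⟨
  toℕ l % 2                             ∎
  where
  open ≡-Reasoning
  s′ = Sum.map (σ ⟨$⟩ʳ_) (ρ ⟨$⟩ʳ_) (toBlocks l)
  blockIndex-map : ∀ s → blockIndex (Sum.map (σ ⟨$⟩ʳ_) (ρ ⟨$⟩ʳ_) s) ≡ blockIndex s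
  blockIndex-map (inj₁ _) = refl
  blockIndex-map (inj₂ _) = refl

sorted : ∀ {N} → ℕ → Tuple N
sorted w j = toℕ j <ᵇ w

weight-sorted : ∀ {N} w → w ≤ N → weight (sorted {N} w) ≡ w
weight-sorted {zero}  zero    _         = refl
weight-sorted {suc N} zero    _         = weight-sorted {N} zero z≤n
weight-sorted {suc N} (suc w) (s≤s w≤N) = cong suc (weight-sorted w w≤N)

toℕ-punchIn-fromℕ : ∀ {N} (j : Fin N) → toℕ (Fin.punchIn (Fin.fromℕ N) j) ≡ toℕ j
toℕ-punchIn-fromℕ Fin.zero    = refl
toℕ-punchIn-fromℕ (Fin.suc j) = cong suc (toℕ-punchIn-fromℕ j)

sortingPermutation : ∀ {N} (u : Tuple N) →
  Σ (Permutation′ N) λ π → ∀ l → u l ≡ sorted (weight u) (π ⟨$⟩ʳ l)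
sortingPermutation {zero}  u = Perm.id , λ ()
sortingPermutation {suc N} u with sortingPermutation (u ∘ Fin.suc) | u Fin.zero in u₀
... | π , sorts | true  = Perm.insert Fin.zero Fin.zero π , sorts′
  where
  sorts′ : ∀ l → u l ≡ sorted (suc (weight (u ∘ Fin.suc))) (Perm.insert Fin.zero Fin.zero π ⟨$⟩ʳ l)
  sorts′ Fin.zero    = u₀
  sorts′ (Fin.suc l) = trans (sorts l) (cong (sorted (suc (weight (u ∘ Fin.suc))))
                                              (sym (Perm.insert-punchIn Fin.zero Fin.zero π l)))
... | π , sorts | false = Perm.insert Fin.zero (Fin.fromℕ N) π , sorts′
  where
  w = weight (u ∘ Fin.suc)
  sorts′ : ∀ l → u l ≡ sorted w (Perm.insert Fin.zero (Fin.fromℕ N) π ⟨$⟩ʳ l)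
  sorts′ Fin.zero    = trans u₀ (sym (trans (cong (_<ᵇ w) (toℕ-fromℕ N)) (<ᵇ-false (weight≤ (u ∘ Fin.suc)))))
  sorts′ (Fin.suc l) = begin
    u (Fin.suc l)
      ≡⟨ sorts l ⟩
    toℕ (π ⟨$⟩ʳ l) <ᵇ w
      ≡⟨ cong (_<ᵇ w) (toℕ-punchIn-fromℕ (π ⟨$⟩ʳ l)) ⟨
    toℕ (Fin.punchIn (Fin.fromℕ N) (π ⟨$⟩ʳ l)) <ᵇ w
      ≡⟨ cong (sorted w) (Perm.insert-punchIn Fin.zero (Fin.fromℕ N) π l) ⟨
    sorted w (Perm.insert Fin.zero (Fin.fromℕ N) π ⟨$⟩ʳ Fin.suc l) ∎
    where open ≡-Reasoning

-- f need not respect pointwise equality of its arguments, so instead of evaluating f at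
-- interleave u v we exhibit a pointwise equal tuple at which its value is known.
blockSymmetric-sorted : ∀ {n} {f : Tuple (twice+1 n) → Bool} → TwoBlockSymmetric (twice+1 n) f →
  (u : Tuple (suc n)) (v : Tuple n) →
  Σ (Tuple (twice+1 n)) λ a → (∀ l → a l ≡ interleave u v l) ×
                              f a ≡ f (interleave (sorted (weight u)) (sorted (weight v)))
blockSymmetric-sorted f-sym u v =
  (λ l → c (π ⟨$⟩ʳ l)) , c∘π≗uv , sym (f-sym π (blockPermutation-parityPreserving σ ρ) c)
  where
  σ = proj₁ (sortingPermutation u)
  ρ = proj₁ (sortingPermutation v)
  π = blockPermutation σ ρ
  c = interleave (sorted (weight u)) (sorted (weight v))
  sorts : ∀ s → [ sorted (weight u) , sorted (weight v) ]′ (Sum.map (σ ⟨$⟩ʳ_) (ρ ⟨$⟩ʳ_) s) ≡ [ u , v ]′ s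
  sorts (inj₁ a) = sym (proj₂ (sortingPermutation u) a)
  sorts (inj₂ b) = sym (proj₂ (sortingPermutation v) b)
  c∘π≗uv : ∀ l → c (π ⟨$⟩ʳ l) ≡ interleave u v l
  c∘π≗uv l = trans (cong [ sorted (weight u) , sorted (weight v) ]′
                          (toBlocks-fromBlocks (Sum.map (σ ⟨$⟩ʳ_) (ρ ⟨$⟩ʳ_) (toBlocks l))))
                    (sorts (toBlocks l))

-- Separating two row weights

Rel-I∪-cong : ∀ {k t} {x y y′ : Tuple k} → (∀ i → y i ≡ y′ i) → Rel-I∪ k t x y → Rel-I∪ k t x y′
Rel-I∪-cong y≗y′ (inj₁ wt)  = inj₁ (trans (sym (weight-cong y≗y′)) wt)
Rel-I∪-cong y≗y′ (inj₂ y≗x) = inj₂ (λ i → trans (sym (y≗y′ i)) (y≗x i))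

Rel-NAE-cong : ∀ {k} {y y′ : Tuple k} → (∀ i → y i ≡ y′ i) → Rel-NAE k y → Rel-NAE k y′
Rel-NAE-cong y≗y′ (i , j , yi , yj) = i , j , trans (sym (y≗y′ i)) yi , trans (sym (y≗y′ j)) yj

copies++uniform : ∀ {k t m} (x : Tuple k) p N′ (r : Fin k → ℕ) → p + N′ ≡ m →
  (∀ i → r i ≤ N′) → ∑[ i < k ] r i ≡ t * N′ →
  Σ (Fin k → Tuple m) λ U → (∀ i → weight (U i) ≡ p * bit (x i) + r i) ×
                             (∀ j → Rel-I∪ k t x (λ i → U i j))
copies++uniform {k} {t} x p N′ r refl r≤N′ ∑r with matrixWithMargins N′ t r r≤N′ ∑r
... | R , rowR , colR = (λ i → replicate p (x i) ++ R i) , row , column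
  where
  row : ∀ i → weight (replicate p (x i) ++ R i) ≡ p * bit (x i) + r i
  row i = trans (weight-++ (replicate p (x i)) (R i)) (cong₂ _+_ (weight-replicate p (x i)) (rowR i))
  column : ∀ j → Rel-I∪ k t x (λ i → (replicate p (x i) ++ R i) j)
  column j with Fin.splitAt p j
  ... | inj₁ _  = inj₂ (λ _ → refl)
  ... | inj₂ j′ = inj₁ (colR j′)

NAE-nonconstant : ∀ {k} {y : Tuple k} b → (∀ i → y i ≡ b) → ¬ Rel-NAE k y
NAE-nonconstant b y≡b (i , j , yi , yj) with trans (sym yi) (y≡b i) | trans (sym yj) (y≡b j)
... | refl | ()

module Separation {k t : ℕ} {x : Tuple k} {n : ℕ} {f : Tuple (twice+1 n) → Bool}
  (f-pol : IsPolymorphism k t x (twice+1 n) f) (f-sym : TwoBlockSymmetric (twice+1 n) f) where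

  F : ℕ → ℕ → Bool
  F a b = f (interleave (sorted a) (sorted b))

  rowValues-NAE : ∀ p N′ B (A : Fin k → ℕ) → p + N′ ≡ suc n →
    (∀ i → p * bit (x i) ≤ A i) → (∀ i → A i ≤ N′) → ∑[ i < k ] A i ≡ p * weight x + t * N′ →
    k * B ≡ n * t → B ≤ n → Rel-NAE k (λ i → F (A i) B)
  rowValues-NAE p N′ B A p+N′≡ xp≤A A≤N′ ∑A k*B≡n*t B≤n = Rel-NAE-cong value (f-pol M columns)
    where
    xp r : Fin k → ℕ
    xp i = p * bit (x i)
    r  i = A i ∸ xp i
    ∑r : ∑[ i < k ] r i ≡ t * N′
    ∑r = begin
      ∑[ i < k ] (A i ∸ xp i)                    ≡⟨ ∑-∸ A xp xp≤A ⟩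
      sum A ∸ sum xp                             ≡⟨ cong₂ _∸_ ∑A (∑-scaled-bits p x) ⟩
      p * weight x + t * N′ ∸ p * weight x       ≡⟨ m+n∸m≡n (p * weight x) (t * N′) ⟩
      t * N′                                     ∎
      where open ≡-Reasoning
    firstBlock : Σ (Fin k → Tuple (suc n)) λ U → (∀ i → weight (U i) ≡ p * bit (x i) + r i) ×
                                                  (∀ j → Rel-I∪ k t x (λ i → U i j))
    firstBlock = copies++uniform x p N′ r p+N′≡ (λ i → ≤-trans (m∸n≤m (A i) (xp i)) (A≤N′ i)) ∑r
    secondBlock : Σ (Fin k → Tuple n) λ W → (∀ i → weight (W i) ≡ B) × (∀ j → weight (λ i → W i j) ≡ t)
    secondBlock = matrixWithMargins n t (λ _ → B) (λ _ → B≤n)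
                                    (trans (∑-const k B) (trans k*B≡n*t (*-comm n t)))
    U : Fin k → Tuple (suc n)
    U = proj₁ firstBlock
    W : Fin k → Tuple n
    W = proj₁ secondBlock
    columns-interleave : ∀ l → Rel-I∪ k t x (λ i → interleave (U i) (W i) l)
    columns-interleave l with toBlocks l
    ... | inj₁ a = proj₂ (proj₂ firstBlock) a
    ... | inj₂ b = inj₁ (proj₂ (proj₂ secondBlock) b)
    M : Fin k → Tuple (twice+1 n)
    M i = proj₁ (blockSymmetric-sorted f-sym (U i) (W i))
    columns : ∀ l → Rel-I∪ k t x (λ i → M i l)
    columns l = Rel-I∪-cong (λ i → sym (proj₁ (proj₂ (blockSymmetric-sorted f-sym (U i) (W i))) l))
                            (columns-interleave l)
    value : ∀ i → f (M i) ≡ F (A i) B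
    value i = trans (proj₂ (proj₂ (blockSymmetric-sorted f-sym (U i) (W i))))
                    (cong₂ F (trans (proj₁ (proj₂ firstBlock) i) (m+[n∸m]≡n (xp≤A i)))
                             (proj₁ (proj₂ secondBlock) i))

  separated : ∀ {p N′ V V′ B} (y : Tuple k) → p + N′ ≡ suc n →
    p ≤ V → p ≤ V′ → V ≤ N′ → V′ ≤ N′ →
    weight y * V + weight (not ∘ y) * V′ ≡ p * weight x + t * N′ →
    k * B ≡ n * t → B ≤ n → F V B ≢ F V′ B
  separated {p} {N′} {V} {V′} {B} y p+N′≡ p≤V p≤V′ V≤N′ V′≤N′ ∑A k*B≡n*t B≤n FV≡FV′ =
    NAE-nonconstant (F V B) collapse
      (rowValues-NAE p N′ B A p+N′≡ xp≤A A≤N′ (trans (∑-if y V V′) ∑A) k*B≡n*t B≤n)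
    where
    A : Fin k → ℕ
    A i = if y i then V else V′
    p≤A : ∀ i → p ≤ A i
    p≤A i with y i
    ... | true  = p≤V
    ... | false = p≤V′
    xp≤A : ∀ i → p * bit (x i) ≤ A i
    xp≤A i = ≤-trans (*-monoʳ-≤ p (bit≤1 (x i))) (subst (_≤ A i) (sym (*-identityʳ p)) (p≤A i))
    A≤N′ : ∀ i → A i ≤ N′
    A≤N′ i with y i
    ... | true  = V≤N′
    ... | false = V′≤N′
    collapse : ∀ i → F (A i) B ≡ F V B
    collapse i with y i
    ... | true  = refl
    ... | false = sym FV≡FV′

-- Three pairwise distinct levels

even⊎odd : ∀ m → Even m ⊎ Odd m
even⊎odd m with m % 2 | m%n<n m 2
... | zero        | _              = inj₁ refl
... | suc zero    | _              = inj₂ refl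
... | suc (suc _) | s≤s (s≤s ())

even⇒double : ∀ m → Even m → ∃ λ h → m ≡ h + h
even⇒double m m%2≡0 = m / 2 , (begin
  m                 ≡⟨ m≡m%n+[m/n]*n m 2 ⟩
  m % 2 + m / 2 * 2 ≡⟨ cong (_+ m / 2 * 2) m%2≡0 ⟩
  m / 2 * 2         ≡⟨ trans (*-comm (m / 2) 2) (cong (m / 2 +_) (+-identityʳ (m / 2))) ⟩
  m / 2 + m / 2     ∎)
  where open ≡-Reasoning

odd-+-odd⇒even : ∀ a b → Odd a → Odd (a + b) → Even b
odd-+-odd⇒even a b a-odd a+b-odd with even⊎odd b
... | inj₁ b-even = b-even
... | inj₂ b-odd with trans (sym a+b-odd) (trans (%-distribˡ-+ a b 2) (cong₂ (λ u v → (u + v) % 2) a-odd b-odd))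
...   | ()

even-+-odd⇒odd : ∀ a b → Even (a + b) → Odd a → Odd b
even-+-odd⇒odd a b a+b-even a-odd with even⊎odd b
... | inj₂ b-odd = b-odd
... | inj₁ b-even with trans (sym a+b-even) (trans (%-distribˡ-+ a b 2) (cong₂ (λ u v → (u + v) % 2) a-odd b-even))
...   | ()

three-distinct-Bools : (a b c : Bool) → b ≢ a → c ≢ b → c ≢ a → ⊥
three-distinct-Bools a b c b≢a c≢b c≢a = c≢b (trans (¬-not c≢a) (sym (¬-not b≢a)))

roundUp : ∀ D L → 1 ≤ D → Σ ℕ λ p → Σ ℕ λ e → p * D ≡ L + e × e < D × p ≤ L
roundUp D       zero    1≤D = 0 , 0 , refl , 1≤D , z≤n
roundUp D       (suc L) 1≤D with roundUp D L 1≤D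
roundUp (suc D) (suc L) _   | p , zero  , pD≡ , _   , p≤L =
  suc p , D , trans (cong (suc D +_) pD≡) (cong suc (trans (+-comm D (L + 0)) (cong (_+ D) (+-identityʳ L)))) ,
  ≤-refl , s≤s p≤L
roundUp D       (suc L) _   | p , suc e , pD≡ , e<D , p≤L =
  p , e , trans pD≡ (+-suc L e) , <⇒≤ e<D , m≤n⇒m≤1+n p≤L

≤-offset : ∀ {m n} c → m + c ≡ n → m ≤ n
≤-offset {m} c m+c≡n = subst (m ≤_) m+c≡n (m≤m+n m c)

-- With k = t + K, s = 4k and n = k s: the room needed in levels-differ for V = s t + α.
offsets-fit : ∀ {t K} α p → 1 ≤ t → 1 ≤ K → α ≤ 3 → p ≤ suc ((t + K) + (t + K)) →
  p ≤ 4 * (t + K) * t + α × 4 * (t + K) * t + α + p ≤ suc ((t + K) * (4 * (t + K)))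
offsets-fit {suc a} {suc b} α p (s≤s z≤n) (s≤s z≤n) α≤3 p≤ =
    ≤-trans p≤ (≤-offset (suc (a + b) + k + 4 * k * a + α) (p-fits a b α))
  , ≤-trans (+-mono-≤ (+-monoʳ-≤ (4 * k * suc a) α≤3) p≤) (≤-offset (1 + 2 * a + 2 * b + 4 * k * b) (V+p-fits a b))
  where
  k : ℕ
  k = suc a + suc b
  p-fits : ∀ a b α → let k = suc a + suc b in
           suc (k + k) + (suc (a + b) + k + 4 * k * a + α) ≡ 4 * k * suc a + α
  p-fits = solve-∀
  V+p-fits : ∀ a b → let k = suc a + suc b in
             4 * k * suc a + 3 + suc (k + k) + (1 + 2 * a + 2 * b + 4 * k * b) ≡ suc (k * (4 * k))
  V+p-fits = solve-∀

half-pos : ∀ h → 1 ≤ h + h → 1 ≤ h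
half-pos (suc h) _ = s≤s z≤n

module Levels {t D K : ℕ} (1≤t : 1 ≤ t) (1≤D : 1 ≤ D) (D<K : D < K)
  {x : Tuple (t + K)} (x-weight : weight x ≡ t + D)
  {f : Tuple (twice+1 ((t + K) * (4 * (t + K)))) → Bool}
  (f-pol : IsPolymorphism (t + K) t x (twice+1 ((t + K) * (4 * (t + K)))) f)
  (f-sym : TwoBlockSymmetric (twice+1 ((t + K) * (4 * (t + K)))) f) where

  k s n : ℕ
  k = t + K
  s = 4 * k
  n = k * s

  open Separation f-pol f-sym using (F; separated)

  level : ℕ → Bool
  level α = F (s * t + α) (s * t)

  1≤K : 1 ≤ K
  1≤K = ≤-trans 1≤D (<⇒≤ D<K)

  levels-differ : ∀ {α α′} w w′ p → w + w′ ≡ k → w * α + w′ * α′ ≡ t + p * D →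
                  α ≤ 3 → α′ ≤ 3 → p ≤ suc (k + k) → level α ≢ level α′
  levels-differ {α} {α′} w w′ p w+w′≡k balance α≤3 α′≤3 p≤ =
    separated (sorted {k} w) p+N′≡ (proj₁ fitα) (proj₁ fitα′) (V≤N′ fitα) (V≤N′ fitα′)
              rowSum (sym (*-assoc k s t)) B≤n
    where
    fitα  = offsets-fit α  p 1≤t 1≤K α≤3  p≤
    fitα′ = offsets-fit α′ p 1≤t 1≤K α′≤3 p≤
    N′ : ℕ
    N′ = suc n ∸ p
    p+N′≡ : p + N′ ≡ suc n
    p+N′≡ = m+[n∸m]≡n (≤-trans (m≤n+m p (s * t + α)) (proj₂ fitα))
    V≤N′ : ∀ {β} → p ≤ s * t + β × s * t + β + p ≤ suc n → s * t + β ≤ N′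
    V≤N′ (_ , fits) = m+n≤o⇒m≤o∸n _ fits
    B≤n : s * t ≤ n
    B≤n = ≤-trans (*-monoʳ-≤ s (m≤m+n t K)) (≤-reflexive (*-comm s k))
    w≤k : w ≤ k
    w≤k = ≤-offset w′ w+w′≡k
    k∸w≡w′ : k ∸ w ≡ w′
    k∸w≡w′ = trans (cong (_∸ w) (sym w+w′≡k)) (m+n∸m≡n w w′)
    distribute : ∀ w w′ c α α′ → w * (c + α) + w′ * (c + α′) ≡ (w + w′) * c + (w * α + w′ * α′)
    distribute = solve-∀
    regroup : ∀ k s t pD → k * (s * t) + (t + pD) ≡ t * suc (k * s) + pD
    regroup = solve-∀
    regroup′ : ∀ t p N′ D → t * (p + N′) + p * D ≡ p * (t + D) + t * N′
    regroup′ = solve-∀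
    rowSum : weight (sorted {k} w) * (s * t + α) + weight (not ∘ sorted {k} w) * (s * t + α′) ≡
             p * weight x + t * N′
    rowSum = begin
      weight (sorted {k} w) * (s * t + α) + weight (not ∘ sorted {k} w) * (s * t + α′)
        ≡⟨ cong₂ (λ a b → a * (s * t + α) + b * (s * t + α′))
                 (weight-sorted {k} w w≤k)
                 (trans (weight-not (sorted {k} w)) (trans (cong (k ∸_) (weight-sorted {k} w w≤k)) k∸w≡w′)) ⟩
      w * (s * t + α) + w′ * (s * t + α′)    ≡⟨ distribute w w′ (s * t) α α′ ⟩
      (w + w′) * (s * t) + (w * α + w′ * α′) ≡⟨ cong₂ (λ a b → a * (s * t) + b) w+w′≡k balance ⟩
      k * (s * t) + (t + p * D)              ≡⟨ regroup k s t (p * D) ⟩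
      t * suc n + p * D                      ≡⟨ cong (λ m → t * m + p * D) p+N′≡ ⟨
      t * (p + N′) + p * D                   ≡⟨ regroup′ t p N′ D ⟩
      p * (t + D) + t * N′                   ≡⟨ cong (λ d → p * d + t * N′) x-weight ⟨
      p * weight x + t * N′                  ∎
      where open ≡-Reasoning

  K≤k+k : K ≤ k + k
  K≤k+k = ≤-trans (m≤n+m K t) (m≤m+n k k)

  K-split : ∀ {e} → suc e ≤ K → suc e + (t + (K ∸ suc e)) ≡ k
  K-split {e} e<K = trans (x∙yz≈y∙xz (suc e) t (K ∸ suc e)) (cong (t +_) (m+[n∸m]≡n e<K))

  level₁≢level₀ : level 1 ≢ level 0
  level₁≢level₀ = levels-differ t K 0 refl (balance t K D) (s≤s z≤n) z≤n z≤n
    where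
    balance : ∀ t K D → t * 1 + K * 0 ≡ t + 0 * D
    balance = solve-∀

  level₂≢level₁ : level 2 ≢ level 1
  level₂≢level₁ with roundUp D (suc K) 1≤D
  ... | p , e , pD≡ , e<D , p≤ =
    levels-differ (suc e) (t + c) p (K-split e<K) balance (s≤s (s≤s z≤n)) (s≤s z≤n)
                  (≤-trans p≤ (s≤s K≤k+k))
    where
    e<K : suc e ≤ K
    e<K = <-trans e<D D<K
    c : ℕ
    c = K ∸ suc e
    regroup : ∀ e t c → suc e * 2 + (t + c) * 1 ≡ t + (suc (suc e + c) + e)
    regroup = solve-∀
    balance : suc e * 2 + (t + c) * 1 ≡ t + p * D
    balance = begin
      suc e * 2 + (t + c) * 1      ≡⟨ regroup e t c ⟩
      t + (suc (suc e + c) + e)    ≡⟨ cong (λ m → t + (suc m + e)) (m+[n∸m]≡n e<K) ⟩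
      t + (suc K + e)              ≡⟨ cong (t +_) pD≡ ⟨
      t + p * D                    ∎
      where open ≡-Reasoning

  level₂≢level₀-t : ∀ h → t ≡ h + h → level 2 ≢ level 0
  level₂≢level₀-t h t≡h+h = levels-differ h (h + K) 0 h+[h+K]≡k balance (s≤s (s≤s z≤n)) z≤n z≤n
    where
    h+[h+K]≡k : h + (h + K) ≡ k
    h+[h+K]≡k = trans (sym (+-assoc h h K)) (cong (_+ K) (sym t≡h+h))
    regroup : ∀ h c D → h * 2 + c * 0 ≡ h + h + 0 * D
    regroup = solve-∀
    balance : h * 2 + (h + K) * 0 ≡ t + 0 * D
    balance = trans (regroup h (h + K) D) (cong (_+ 0 * D) (sym t≡h+h))

  level₂≢level₀-d : ∀ h → t + D ≡ h + h → level 2 ≢ level 0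
  level₂≢level₀-d h d≡h+h = levels-differ h (k ∸ h) 1 (m+[n∸m]≡n h≤k) balance (s≤s (s≤s z≤n)) z≤n (s≤s z≤n)
    where
    h≤k : h ≤ k
    h≤k = ≤-trans (m≤m+n h h) (≤-trans (≤-reflexive (sym d≡h+h)) (+-monoʳ-≤ t (<⇒≤ D<K)))
    regroup : ∀ h c D → h * 2 + c * 0 ≡ h + h
    regroup = solve-∀
    balance : h * 2 + (k ∸ h) * 0 ≡ t + 1 * D
    balance = trans (regroup h (k ∸ h) D) (trans (sym d≡h+h) (cong (t +_) (sym (*-identityˡ D))))

  level₃≢level₂ : level 3 ≢ level 2
  level₃≢level₂ with roundUp D (suc (t + K + K)) 1≤D
  ... | p , e , pD≡ , e<D , p≤ =
    levels-differ (suc e) (t + c) p (K-split e<K) balance ≤-refl (s≤s (s≤s z≤n))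
                  (≤-trans p≤ (s≤s (+-monoʳ-≤ k (m≤n+m K t))))
    where
    e<K : suc e ≤ K
    e<K = <-trans e<D D<K
    c : ℕ
    c = K ∸ suc e
    regroup : ∀ e t c → suc e * 3 + (t + c) * 2 ≡ t + (suc (t + (suc e + c) + (suc e + c)) + e)
    regroup = solve-∀
    balance : suc e * 3 + (t + c) * 2 ≡ t + p * D
    balance = begin
      suc e * 3 + (t + c) * 2                         ≡⟨ regroup e t c ⟩
      t + (suc (t + (suc e + c) + (suc e + c)) + e)   ≡⟨ cong (λ m → t + (suc (t + m + m) + e)) (m+[n∸m]≡n e<K) ⟩
      t + (suc (t + K + K) + e)                       ≡⟨ cong (t +_) pD≡ ⟨
      t + p * D                                       ∎
      where open ≡-Reasoning

  level₃≢level₁ : ∀ D′ K′ → D ≡ D′ + D′ → K ≡ K′ + K′ → level 3 ≢ level 1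
  level₃≢level₁ D′ K′ D≡ K≡ with roundUp D′ (suc K′) (half-pos D′ (subst (1 ≤_) D≡ 1≤D))
  ... | p , e , pD′≡ , e<D′ , p≤ =
    levels-differ (suc e) (t + c) p (K-split e<K) balance ≤-refl (s≤s z≤n)
                  (≤-trans p≤ (s≤s (≤-trans (m≤m+n K′ K′) (subst (_≤ k + k) K≡ K≤k+k))))
    where
    e<K : suc e ≤ K
    e<K = ≤-trans e<D′ (≤-trans (m≤m+n D′ D′) (≤-trans (≤-reflexive (sym D≡)) (<⇒≤ D<K)))
    c : ℕ
    c = K ∸ suc e
    regroup : ∀ e t c → suc e * 3 + (t + c) * 1 ≡ t + (2 + (suc e + c) + (e + e))
    regroup = solve-∀
    regroup′ : ∀ K′ e → 2 + (K′ + K′) + (e + e) ≡ (suc K′ + e) + (suc K′ + e)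
    regroup′ = solve-∀
    balance : suc e * 3 + (t + c) * 1 ≡ t + p * D
    balance = begin
      suc e * 3 + (t + c) * 1               ≡⟨ regroup e t c ⟩
      t + (2 + (suc e + c) + (e + e))       ≡⟨ cong (λ m → t + (2 + m + (e + e))) (trans (m+[n∸m]≡n e<K) K≡) ⟩
      t + (2 + (K′ + K′) + (e + e))         ≡⟨ cong (t +_) (regroup′ K′ e) ⟩
      t + ((suc K′ + e) + (suc K′ + e))     ≡⟨ cong (λ m → t + (m + m)) pD′≡ ⟨
      t + (p * D′ + p * D′)                 ≡⟨ cong (t +_) (*-distribˡ-+ p D′ D′) ⟨
      t + p * (D′ + D′)                     ≡⟨ cong (λ m → t + p * m) D≡ ⟨
      t + p * D                             ∎
      where open ≡-Reasoning

  impossible : ¬ (Odd t × Even k × Odd (t + D)) → ⊥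
  impossible parity-ok with even⊎odd t
  ... | inj₁ t-even with even⇒double t t-even
  ...   | h , t≡h+h = three-distinct-Bools (level 0) (level 1) (level 2)
                        level₁≢level₀ level₂≢level₁ (level₂≢level₀-t h t≡h+h)
  impossible parity-ok | inj₂ t-odd with even⊎odd (t + D)
  ... | inj₁ d-even with even⇒double (t + D) d-even
  ...   | h , d≡h+h = three-distinct-Bools (level 0) (level 1) (level 2)
                        level₁≢level₀ level₂≢level₁ (level₂≢level₀-d h d≡h+h)
  impossible parity-ok | inj₂ t-odd | inj₂ d-odd with even⊎odd k
  ... | inj₁ k-even = parity-ok (t-odd , k-even , d-odd)
  ... | inj₂ k-odd with even⇒double D (odd-+-odd⇒even t D t-odd d-odd)
                      | even⇒double K (odd-+-odd⇒even t K t-odd k-odd)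
  ...   | D′ , D≡D′+D′ | K′ , K≡K′+K′ = three-distinct-Bools (level 1) (level 2) (level 3)
                                         level₂≢level₁ level₃≢level₂ (level₃≢level₁ D′ K′ D≡D′+D′ K≡K′+K′)

NoBlockSymmetricPolymorphism : (k t : ℕ) → Tuple k → ℕ → Set
NoBlockSymmetricPolymorphism k t x m =
  ¬ (Σ (Tuple m → Bool) λ f → IsPolymorphism k t x m f × TwoBlockSymmetric m f)

noBlockSymmetricPolymorphism-t<d : ∀ {k t d} → 1 ≤ t → t < d → d < k → (x : Tuple k) → weight x ≡ d →
  ¬ (Odd t × Even k × Odd d) → ∃ λ m → Odd m × NoBlockSymmetricPolymorphism k t x m
noBlockSymmetricPolymorphism-t<d {k} {t} {d} 1≤t t<d d<k =
  at-offsets (sym (m+[n∸m]≡n (<⇒≤ (<-trans t<d d<k)))) (sym (m+[n∸m]≡n (<⇒≤ t<d)))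
    (m<n⇒0<n∸m t<d) (∸-monoˡ-< d<k (<⇒≤ t<d))
  where
  at-offsets : ∀ {K D} → k ≡ t + K → d ≡ t + D → 1 ≤ D → D < K → (x : Tuple k) → weight x ≡ d →
               ¬ (Odd t × Even k × Odd d) → ∃ λ m → Odd m × NoBlockSymmetricPolymorphism k t x m
  at-offsets {K} refl refl 1≤D D<K x x-weight parity-ok =
    twice+1 n , twice+1-odd n ,
    λ (f , f-pol , f-sym) → Levels.impossible 1≤t 1≤D D<K x-weight f-pol f-sym parity-ok
    where
    n : ℕ
    n = (t + K) * (4 * (t + K))

-- Complementation

complement-polymorphism : ∀ {k t m x f} → t ≤ k → IsPolymorphism k t x m f →
  IsPolymorphism k (k ∸ t) (not ∘ x) m (f ∘ (not ∘_))
complement-polymorphism {k} {t} {m} {x} t≤k f-pol M columns = f-pol (λ i → not ∘ M i) columns′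
  where
  columns′ : ∀ j → Rel-I∪ k t x (λ i → not (M i j))
  columns′ j with columns j
  ... | inj₁ wt  = inj₁ (trans (weight-not (λ i → M i j)) (trans (cong (k ∸_) wt) (m∸[m∸n]≡n t≤k)))
  ... | inj₂ M≗x = inj₂ (λ i → trans (cong not (M≗x i)) (not-involutive (x i)))

complement-blockSymmetric : ∀ {m f} → TwoBlockSymmetric m f → TwoBlockSymmetric m (f ∘ (not ∘_))
complement-blockSymmetric f-sym π π-parity a = f-sym π π-parity (not ∘ a)

noBlockSymmetricPolymorphism-complement : ∀ {k t x m} → t ≤ k →
  NoBlockSymmetricPolymorphism k (k ∸ t) (not ∘ x) m → NoBlockSymmetricPolymorphism k t x m
noBlockSymmetricPolymorphism-complement t≤k none (f , f-pol , f-sym) =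
  none (f ∘ (not ∘_) , complement-polymorphism {f = f} t≤k f-pol , complement-blockSymmetric f-sym)

complement-parity : ∀ {k t d} → t ≤ k → d ≤ k → ¬ (Odd t × Even k × Odd d) →
  ¬ (Odd (k ∸ t) × Even k × Odd (k ∸ d))
complement-parity {k} {t} {d} t≤k d≤k parity-ok (k∸t-odd , k-even , k∸d-odd) =
  parity-ok (even-+-odd⇒odd (k ∸ t) t (subst Even (sym (m∸n+n≡m t≤k)) k-even) k∸t-odd , k-even ,
             even-+-odd⇒odd (k ∸ d) d (subst Even (sym (m∸n+n≡m d≤k)) k-even) k∸d-odd)

theorem4p1 : (k t d : ℕ) → 3 ≤ k → 1 ≤ t → t < k →
    (x : Tuple k) → weight x ≡ d → 1 ≤ d → d < k → d ≢ t →
    ¬ (Odd t × Even k × Odd d) →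
    ∃ λ (m : ℕ) → Odd m ×
      ¬ (Σ (Tuple m → Bool) λ f →
           IsPolymorphism k t x m f × TwoBlockSymmetric m f)
theorem4p1 k t d _ 1≤t t<k x x-weight 1≤d d<k d≢t parity-ok with <-cmp t d
... | tri< t<d _ _ = noBlockSymmetricPolymorphism-t<d 1≤t t<d d<k x x-weight parity-ok
... | tri≈ _ t≡d _ = ⊥-elim (d≢t (sym t≡d))
... | tri> _ _ d<t
  with noBlockSymmetricPolymorphism-t<d (m<n⇒0<n∸m t<k) (∸-monoʳ-< d<t (<⇒≤ t<k)) (∸-monoʳ-< 1≤d (<⇒≤ d<k))
         (not ∘ x) (trans (weight-not x) (cong (k ∸_) x-weight))
         (complement-parity (<⇒≤ t<k) (<⇒≤ d<k) parity-ok)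
...   | m , m-odd , none = m , m-odd , noBlockSymmetricPolymorphism-complement (<⇒≤ t<k) none
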